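{- Let $p$ be an odd prime, let $E$ be an elliptic curve over an algebraically closed field $\bar k$ of characteristic different from $p$, and let $\gamma,\gamma'$ be two multiplicative generators of $\mathbb{F}_{p^2}^{\times}$. Then there is a canonical bijection between the set of oriented $\gamma$-necklaces of $E$ and the set of oriented $\gamma'$-necklaces of $E$.
   Context: For a generator $\gamma$ of $\mathbb{F}_{p^2}^{\times}$ and a $2$-dimensional $\mathbb{F}_p$-vector space $V$, let $\mathcal{C}_\gamma\subset \mathrm{PGL}(V)$ be the set (a conjugacy class) of all elements having a representative in $\mathrm{GL}(V)$ whose characteristic polynomial equals the minimal polynomial of $\gamma$ over $\mathbb{F}_p$. $E[p]$ has exactly $p+1$ cyclic subgroups of order $p$. Consider lists $(C_0,C_1,\dots,C_p)$ enumerating all of them, two lists being equivalent if one is obtained from the other by a cyclic permutation. An equivalence class $(C_0,\dots,C_p)$ is an oriented $\gamma$-necklace of $E$ if there exists $h\in\mathcal{C}_\gamma\subset\mathrm{PGL}(E[p])$ with $h(C_i)=C_{i+1}$ for all $i=0,\dots,p-1$. -}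

module Defs where

open import Data.Nat using (ℕ; zero; suc; _+_; _*_; _∸_; NonZero)
open import Data.Nat.DivMod using (_%_; m%n<n)
open import Data.Fin using (Fin; toℕ; fromℕ<; inject₁) renaming (suc to fsuc; _≟_ to _≟F_)
open import Data.Bool using (Bool; true)
open import Data.List using (List; []; _∷_)
open import Data.Product using (Σ; ∃; _×_; _,_)
open import Relation.Binary.PropositionalEquality using (_≡_; _≢_)
open import Relation.Nullary using (yes; no)

_↔′_ : Set → Set → Set
A ↔′ B = (A → B) × (B → A)

-- Everything is set up for a fixed modulus p (later assumed an odd prime)
-- and a fixed non-square d of F_p (used to build the model F_p[√d] of F_{p²}).
module Setup (p : ℕ) {{nz : NonZero p}} (d : Fin p) where

  Fp : Set
  Fp = Fin p

  mod : ℕ → Fp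
  mod n = fromℕ< (m%n<n n p)

  0F 1F : Fp
  0F = mod 0
  1F = mod 1

  _+F_ _*F_ : Fp → Fp → Fp
  a +F b = mod (toℕ a + toℕ b)
  a *F b = mod (toℕ a * toℕ b)

  -F_ : Fp → Fp
  -F a = mod (p ∸ toℕ a)

  _-F_ : Fp → Fp → Fp
  a -F b = a +F (-F b)

  -- d is a non-square in F_p (so F_p[√d] is a field with p² elements)
  NonSquare : Fp → Set
  NonSquare x = ∀ y → y *F y ≢ x

  -- The field F_{p²} = F_p[√d]: (a , b) stands for a + b √d
  Fp2 : Set
  Fp2 = Fp × Fp

  0F2 1F2 : Fp2
  0F2 = 0F , 0F
  1F2 = 1F , 0F

  _*F2_ : Fp2 → Fp2 → Fp2
  (a , b) *F2 (c , e) = ((a *F c) +F (d *F (b *F e))) , ((a *F e) +F (b *F c))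

  pow : Fp2 → ℕ → Fp2
  pow x zero = 1F2
  pow x (suc n) = x *F2 pow x n

  IsGenerator : Fp2 → Set
  IsGenerator γ = ∀ x → x ≢ 0F2 → ∃ λ n → pow γ n ≡ x

  -- Monic polynomials over F_p as coefficient lists (constant term first)
  Poly : Set
  Poly = List Fp

  minpoly : Fp2 → Poly
  minpoly (a , b) with b ≟F 0F
  ... | yes _ = (-F a) ∷ 1F ∷ []
  ... | no _  = ((a *F a) -F (d *F (b *F b))) ∷ (-F (a +F a)) ∷ 1F ∷ []

  -- The 2-dimensional F_p-vector space V = F_p² (model of E[p])
  V : Set
  V = Fp × Fp

  0V : V
  0V = 0F , 0F

  _•_ : Fp → V → V
  c • (x , y) = (c *F x) , (c *F y)

  -- 2×2 matrices (a b ; c e), acting on column vectors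
  Mat : Set
  Mat = Fp × Fp × Fp × Fp

  act : Mat → V → V
  act (a , b , c , e) (x , y) = ((a *F x) +F (b *F y)) , ((c *F x) +F (e *F y))

  tr det : Mat → Fp
  tr (a , b , c , e) = a +F e
  det (a , b , c , e) = (a *F e) -F (b *F c)

  charpoly : Mat → Poly
  charpoly M = det M ∷ (-F tr M) ∷ 1F ∷ []

  -- M ∈ GL(V) is a representative of an element of the class 𝒞_γ ⊂ PGL(V)
  InClass : Fp2 → Mat → Set
  InClass γ M = (det M ≢ 0F) × (charpoly M ≡ minpoly γ)

  -- Subsets of V (decidable), and the cyclic subgroups of order p:
  -- subgroups generated by a single element of order p (= a nonzero vector)
  Sub : Set
  Sub = V → Bool

  _≈S_ : Sub → Sub → Set
  C ≈S D = ∀ w → C w ≡ D w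

  IsCyclicP : Sub → Set
  IsCyclicP C = Σ V λ v → (v ≢ 0V) × (∀ w → (C w ≡ true) ↔′ (∃ λ c → w ≡ c • v))

  MapsOnto : Mat → Sub → Sub → Set
  MapsOnto M C D = ∀ w → (D w ≡ true) ↔′ (Σ V λ v → (C v ≡ true) × (act M v ≡ w))

  Enum : Set
  Enum = Fin (suc p) → Sub

  IsEnumeration : Enum → Set
  IsEnumeration L = (∀ i → IsCyclicP (L i))
                  × (∀ i j → L i ≈S L j → i ≡ j)
                  × (∀ C → IsCyclicP C → ∃ λ i → L i ≈S C)

  _⊕_ : Fin (suc p) → Fin (suc p) → Fin (suc p)
  i ⊕ k = fromℕ< (m%n<n (toℕ i + toℕ k) (suc p))

  _~_ : Enum → Enum → Set
  L ~ L' = ∃ λ k → ∀ i → L' i ≈S L (i ⊕ k)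

  -- (a representative of) an oriented γ-necklace:
  -- some h ∈ 𝒞_γ (represented by M) with h(C_i) = C_{i+1}, i = 0,…,p-1
  IsNecklace : Fp2 → Enum → Set
  IsNecklace γ L = IsEnumeration L
                 × (Σ Mat λ M → InClass γ M × (∀ (i : Fin p) → MapsOnto M (L (inject₁ i)) (L (fsuc i))))

  -- A bijection between the set of oriented γ-necklaces and the set of
  -- oriented γ'-necklaces (the sets of ~-classes of lists), given by maps on
  -- representatives that respect ~ and are mutually inverse up to ~.
  NecklaceBijection : Fp2 → Fp2 → (Enum → Enum) → (Enum → Enum) → Set
  NecklaceBijection γ γ' F G =
      (∀ L → IsNecklace γ L → IsNecklace γ' (F L))
    × (∀ L → IsNecklace γ' L → IsNecklace γ (G L))
    × (∀ L L' → IsNecklace γ L → IsNecklace γ L' → L ~ L' → F L ~ F L')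
    × (∀ L L' → IsNecklace γ' L → IsNecklace γ' L' → L ~ L' → G L ~ G L')
    × (∀ L → IsNecklace γ L → G (F L) ~ L)
    × (∀ L → IsNecklace γ' L → F (G L) ~ L)

  -- Canonicity: compatibility with every automorphism g ∈ GL(V) (i.e. with
  -- every change of identification E[p] ≅ F_p²): if g maps the list L
  -- termwise onto L', then g maps F L termwise onto a rotation of F L'.
  Equivariant : Fp2 → (Enum → Enum) → Set
  Equivariant γ F = ∀ g L L' → det g ≢ 0F → IsNecklace γ L → IsNecklace γ L'
    → (∀ i → MapsOnto g (L i) (L' i))
    → ∃ λ k → ∀ i → MapsOnto g (F L i) (F L' (i ⊕ k))

{-# OPTIONS --safe #-}
-- Write γ′ = γ^j and γ = γ′^m. If h ∈ 𝒞_γ moves a necklace along, C_i ↦ C_(i+1), then h^j lies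
-- in 𝒞_γ′ and moves C_i to C_(i+j), so i ↦ C_(j i) is a γ′-necklace. That h^n ∈ 𝒞_(γ^n) is
-- Cayley–Hamilton: for γ = a + b√d and γ^n = x + y√d one has b h^n = (b x − a y) I + y h.
-- The same formula turns γ^(m j) = γ into h^(m j) = h; as h cyclically permutes the p + 1 lines
-- C_i, this forces m j ≡ 1 mod p + 1. Hence reindexing by m inverts reindexing by j, rotations go
-- to rotations, and reindexing commutes with every change of basis of E[p].
module Submission where

open import Defs
open import Data.Nat using (ℕ; NonZero; _%_)
open import Data.Nat.Primality using (Prime)
open import Data.Fin using (Fin)
open import Data.Product using (Σ; _×_)
open import Relation.Binary.PropositionalEquality using (_≡_)

open import Algebra.Bundles using (CommutativeRing; RawRing)
open import Algebra.Consequences.Propositional using (comm∧idˡ⇒id; comm∧invˡ⇒inv; comm∧distrˡ⇒distrʳ)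
open import Algebra.Definitions
  using (Associative; Commutative; Identity; LeftIdentity; RightIdentity; LeftInverse; _DistributesOverˡ_)
open import Algebra.Solver.Ring.AlmostCommutativeRing using (fromCommutativeRing; _-Raw-AlmostCommutative⟶_)
open import Algebra.Structures using (IsCommutativeRing)
open import Data.Bool using (true)
open import Data.Bool.Properties using (⇔→≡; T-≡)
open import Data.Empty using (⊥-elim)
open import Data.Fin using (toℕ; fromℕ; inject₁) renaming (zero to fzero; suc to fsuc; _≟_ to _≟F_)
open import Data.Fin.Properties
  using (toℕ-fromℕ<; toℕ-injective; toℕ<n; toℕ-fromℕ; toℕ-inject₁; fromℕ≢inject₁; any?)
open import Data.Fin.Relation.Unary.Top using (view; ‵fromℕ; ‵inject₁)
open import Data.List using (_∷_; [])
open import Data.List.Properties using (∷-injective)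
open import Data.Maybe using (Maybe; just; nothing)
open import Data.Nat using (zero; suc; pred; _+_; _*_; _∸_; _≟_; s≤s; nonTrivial⇒n>1)
open import Data.Nat.Divisibility using (_∣_; m%n≡0⇒n∣m; n∣m⇒m%n≡0)
open import Data.Nat.DivMod using (m%n<n; [m+n]%n≡m%n; m<n⇒m%n≡m; %-distribˡ-+; %-distribˡ-*; m*n%n≡0; n%n≡0)
open import Data.Nat.Primality using (euclidsLemma; prime⇒nonTrivial)
open import Data.Nat.Properties
  using ( +-assoc; +-comm; +-identityʳ; +-suc; *-assoc; *-comm; *-identityˡ; *-identityʳ; *-suc
        ; *-distribˡ-+; m∸n+n≡m; <⇒≤; suc-pred; 1+n≢0)
open import Data.Nat.Tactic.RingSolver using (solve-∀)
open import Data.Product using (_,_; ∃; proj₁; proj₂; swap)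
open import Data.Product.Properties using (≡-dec)
open import Data.Sum using (_⊎_; inj₁; inj₂)
open import Function using (_∘_)
open import Function.Bundles using (mk⇔; Equivalence)
open import Relation.Binary.Definitions using (DecidableEquality)
open import Relation.Binary.PropositionalEquality
  using (_≢_; refl; sym; trans; cong; cong₂; subst; isEquivalence; module ≡-Reasoning)
open import Relation.Nullary using (Dec; yes; no)
open import Relation.Nullary.Decidable using (isYes; toWitness; fromWitness)

module Modulo (n : ℕ) .{{_ : NonZero n}} where
  open import Data.Nat.DivMod using (_mod_)

  toℕ-mod : ∀ m → toℕ (m mod n) ≡ m % n
  toℕ-mod m = toℕ-fromℕ< (m%n<n m n)

  mod-toℕ : ∀ (i : Fin n) → toℕ i mod n ≡ i
  mod-toℕ i = toℕ-injective (trans (toℕ-mod (toℕ i)) (m<n⇒m%n≡m (toℕ<n i)))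

  %≡⇒mod≡ : ∀ {m k} → m % n ≡ k % n → m mod n ≡ k mod n
  %≡⇒mod≡ {m} {k} e = toℕ-injective (trans (toℕ-mod m) (trans e (sym (toℕ-mod k))))

  mod≡⇒%≡ : ∀ {m k} → m mod n ≡ k mod n → m % n ≡ k % n
  mod≡⇒%≡ {m} {k} e = trans (sym (toℕ-mod m)) (trans (cong toℕ e) (toℕ-mod k))

  mod-multiple : ∀ m → (m * n) mod n ≡ 0 mod n
  mod-multiple m = %≡⇒mod≡ (trans (m*n%n≡0 m n) (sym (m*n%n≡0 0 n)))

  mod-+-self : ∀ m → (m + n) mod n ≡ m mod n
  mod-+-self m = %≡⇒mod≡ ([m+n]%n≡m%n m n)

  mod-+ : ∀ m k → (m + k) mod n ≡ (toℕ (m mod n) + toℕ (k mod n)) mod n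
  mod-+ m k = %≡⇒mod≡ (trans (%-distribˡ-+ m k n) (sym (cong₂ (λ a b → (a + b) % n) (toℕ-mod m) (toℕ-mod k))))

  mod-* : ∀ m k → (m * k) mod n ≡ (toℕ (m mod n) * toℕ (k mod n)) mod n
  mod-* m k = %≡⇒mod≡ (trans (%-distribˡ-* m k n) (sym (cong₂ (λ a b → (a * b) % n) (toℕ-mod m) (toℕ-mod k))))

  mod-+-toℕ : ∀ m k → (m + toℕ (k mod n)) mod n ≡ (m + k) mod n
  mod-+-toℕ m k = begin
    (m + toℕ (k mod n)) mod n                   ≡⟨ mod-+ m (toℕ (k mod n)) ⟩
    (toℕ (m mod n) + toℕ (toℕ (k mod n) mod n)) mod n ≡⟨ cong (λ i → (toℕ (m mod n) + toℕ i) mod n) (mod-toℕ (k mod n)) ⟩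
    (toℕ (m mod n) + toℕ (k mod n)) mod n       ≡⟨ sym (mod-+ m k) ⟩
    (m + k) mod n                               ∎
    where open ≡-Reasoning

  mod-*-toℕ : ∀ m k → (m * toℕ (k mod n)) mod n ≡ (m * k) mod n
  mod-*-toℕ m k = begin
    (m * toℕ (k mod n)) mod n                   ≡⟨ mod-* m (toℕ (k mod n)) ⟩
    (toℕ (m mod n) * toℕ (toℕ (k mod n) mod n)) mod n ≡⟨ cong (λ i → (toℕ (m mod n) * toℕ i) mod n) (mod-toℕ (k mod n)) ⟩
    (toℕ (m mod n) * toℕ (k mod n)) mod n       ≡⟨ sym (mod-* m k) ⟩
    (m * k) mod n                               ∎
    where open ≡-Reasoning

module FpRing (p : ℕ) {{_ : NonZero p}} (d : Fin p) where
  open Setup p d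
  open Modulo p
  open ≡-Reasoning

  +F-assoc : Associative _≡_ _+F_
  +F-assoc a b c = begin
    (a +F b) +F c                      ≡⟨ cong ((a +F b) +F_) (sym (mod-toℕ c)) ⟩
    mod (toℕ a + toℕ b) +F mod (toℕ c) ≡⟨ sym (mod-+ _ _) ⟩
    mod (toℕ a + toℕ b + toℕ c)        ≡⟨ cong mod (+-assoc (toℕ a) _ _) ⟩
    mod (toℕ a + (toℕ b + toℕ c))      ≡⟨ mod-+ _ _ ⟩
    mod (toℕ a) +F (b +F c)            ≡⟨ cong (_+F (b +F c)) (mod-toℕ a) ⟩
    a +F (b +F c)                      ∎

  *F-assoc : Associative _≡_ _*F_
  *F-assoc a b c = begin
    (a *F b) *F c                      ≡⟨ cong ((a *F b) *F_) (sym (mod-toℕ c)) ⟩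
    mod (toℕ a * toℕ b) *F mod (toℕ c) ≡⟨ sym (mod-* _ _) ⟩
    mod (toℕ a * toℕ b * toℕ c)        ≡⟨ cong mod (*-assoc (toℕ a) _ _) ⟩
    mod (toℕ a * (toℕ b * toℕ c))      ≡⟨ mod-* _ _ ⟩
    mod (toℕ a) *F (b *F c)            ≡⟨ cong (_*F (b *F c)) (mod-toℕ a) ⟩
    a *F (b *F c)                      ∎

  +F-comm : Commutative _≡_ _+F_
  +F-comm a b = cong mod (+-comm (toℕ a) (toℕ b))

  *F-comm : Commutative _≡_ _*F_
  *F-comm a b = cong mod (*-comm (toℕ a) (toℕ b))

  +F-identityˡ : LeftIdentity _≡_ 0F _+F_
  +F-identityˡ a = begin
    0F +F a          ≡⟨ cong (0F +F_) (sym (mod-toℕ a)) ⟩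
    0F +F mod (toℕ a) ≡⟨ sym (mod-+ 0 (toℕ a)) ⟩
    mod (toℕ a)      ≡⟨ mod-toℕ a ⟩
    a                ∎

  *F-identityˡ : LeftIdentity _≡_ 1F _*F_
  *F-identityˡ a = begin
    1F *F a              ≡⟨ cong (1F *F_) (sym (mod-toℕ a)) ⟩
    1F *F mod (toℕ a)    ≡⟨ sym (mod-* 1 (toℕ a)) ⟩
    mod (1 * toℕ a)      ≡⟨ cong mod (*-identityˡ (toℕ a)) ⟩
    mod (toℕ a)          ≡⟨ mod-toℕ a ⟩
    a                    ∎

  -F-inverseˡ : LeftInverse _≡_ 0F -F_ _+F_
  -F-inverseˡ a = begin
    (-F a) +F a                 ≡⟨ cong ((-F a) +F_) (sym (mod-toℕ a)) ⟩
    (-F a) +F mod (toℕ a)        ≡⟨ sym (mod-+ (p ∸ toℕ a) (toℕ a)) ⟩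
    mod (p ∸ toℕ a + toℕ a)      ≡⟨ cong mod (m∸n+n≡m (<⇒≤ (toℕ<n a))) ⟩
    mod (0 + p)                  ≡⟨ mod-+-self 0 ⟩
    0F                           ∎

  *F-distribˡ-+F : _DistributesOverˡ_ _≡_ _*F_ _+F_
  *F-distribˡ-+F a b c = begin
    a *F (b +F c)                          ≡⟨ cong (_*F (b +F c)) (sym (mod-toℕ a)) ⟩
    mod (toℕ a) *F mod (toℕ b + toℕ c)     ≡⟨ sym (mod-* _ _) ⟩
    mod (toℕ a * (toℕ b + toℕ c))          ≡⟨ cong mod (*-distribˡ-+ (toℕ a) _ _) ⟩
    mod (toℕ a * toℕ b + toℕ a * toℕ c)    ≡⟨ mod-+ _ _ ⟩
    (a *F b) +F (a *F c)                   ∎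

  +F-*F-isCommutativeRing : IsCommutativeRing _≡_ _+F_ _*F_ (-F_) 0F 1F
  +F-*F-isCommutativeRing = record
    { isRing = record
      { +-isAbelianGroup = record
        { isGroup = record
          { isMonoid = record
            { isSemigroup = record
              { isMagma = record { isEquivalence = isEquivalence ; ∙-cong = cong₂ _+F_ }
              ; assoc = +F-assoc
              }
            ; identity = comm∧idˡ⇒id +F-comm +F-identityˡ
            }
          ; inverse = comm∧invˡ⇒inv +F-comm -F-inverseˡ
          ; ⁻¹-cong = cong (-F_)
          }
        ; comm = +F-comm
        }
      ; *-cong = cong₂ _*F_
      ; *-assoc = *F-assoc
      ; *-identity = comm∧idˡ⇒id *F-comm *F-identityˡ
      ; distrib = *F-distribˡ-+F , comm∧distrˡ⇒distrʳ *F-comm *F-distribˡ-+F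
      }
    ; *-comm = *F-comm
    }

  Fp-commutativeRing : CommutativeRing _ _
  Fp-commutativeRing = record { isCommutativeRing = +F-*F-isCommutativeRing }

  open import Algebra.Properties.Ring (CommutativeRing.ring Fp-commutativeRing) public
    using (+-inverseʳ-unique; -‿involutive; -‿injective; x[y-z]≈xy-xz; x∙y⁻¹≈ε⇒x≈y; x≈y⇒x∙y⁻¹≈ε)

  q : ℕ
  q = pred p

  mod-*q : ∀ n → mod (n * q) ≡ -F mod n
  mod-*q n = +-inverseʳ-unique (mod n) (mod (n * q)) (begin
    mod n +F mod (n * q)  ≡⟨ sym (mod-+ n (n * q)) ⟩
    mod (n + n * q)       ≡⟨ cong mod (sym (*-suc n q)) ⟩
    mod (n * suc q)       ≡⟨ cong (λ k → mod (n * k)) (suc-pred p) ⟩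
    mod (n * p)           ≡⟨ mod-multiple n ⟩
    0F                    ∎)

  mod-*q*q : ∀ n → mod (n * q * q) ≡ mod n
  mod-*q*q n = begin
    mod (n * q * q)  ≡⟨ mod-*q (n * q) ⟩
    -F mod (n * q)   ≡⟨ cong (-F_) (mod-*q n) ⟩
    -F (-F mod n)    ≡⟨ -‿involutive (mod n) ⟩
    mod n            ∎

  -- Ring-solver coefficients: (a , b) stands for the integer a − b, kept in the
  -- normal form with one component 0 so that equal integers are equal pairs.
  -- In F_p it denotes a + b q, as q = p − 1 acts as −1.

  normalise : ℕ × ℕ → ℕ × ℕ
  normalise (a , b) = a ∸ b , b ∸ a

  _⊞_ _⊠_ : ℕ × ℕ → ℕ × ℕ → ℕ × ℕ
  (a , b) ⊞ (c , e) = normalise (a + c , b + e)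
  (a , b) ⊠ (c , e) = normalise (a * c + b * e , a * e + b * c)

  Coefficients : RawRing _ _
  Coefficients = record
    { _≈_ = _≡_ ; _+_ = _⊞_ ; _*_ = _⊠_ ; -_ = swap ; 0# = 0 , 0 ; 1# = 1 , 0 }

  ⟦_⟧ᶜ : ℕ × ℕ → Fp
  ⟦ a , b ⟧ᶜ = mod (a + b * q)

  ⟦⟧ᶜ-normalise : ∀ x → ⟦ normalise x ⟧ᶜ ≡ ⟦ x ⟧ᶜ
  ⟦⟧ᶜ-normalise (zero  , zero)  = refl
  ⟦⟧ᶜ-normalise (zero  , suc b) = refl
  ⟦⟧ᶜ-normalise (suc a , zero)  = refl
  ⟦⟧ᶜ-normalise (suc a , suc b) = begin
    ⟦ normalise (a , b) ⟧ᶜ        ≡⟨ ⟦⟧ᶜ-normalise (a , b) ⟩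
    mod (a + b * q)               ≡⟨ sym (mod-+-self (a + b * q)) ⟩
    mod (a + b * q + p)           ≡⟨ cong (λ k → mod (a + b * q + k)) (sym (suc-pred p)) ⟩
    mod (a + b * q + suc q)       ≡⟨ cong mod (rearrange a b q) ⟩
    mod (suc a + suc b * q)       ∎
    where
    rearrange : ∀ a b q → a + b * q + suc q ≡ suc a + suc b * q
    rearrange = solve-∀

  ⊞-homo : ∀ x y → ⟦ x ⊞ y ⟧ᶜ ≡ ⟦ x ⟧ᶜ +F ⟦ y ⟧ᶜ
  ⊞-homo (a , b) (c , e) = begin
    ⟦ normalise (a + c , b + e) ⟧ᶜ  ≡⟨ ⟦⟧ᶜ-normalise (a + c , b + e) ⟩
    mod (a + c + (b + e) * q)       ≡⟨ cong mod (rearrange a b c e q) ⟩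
    mod (a + b * q + (c + e * q))   ≡⟨ mod-+ _ _ ⟩
    ⟦ a , b ⟧ᶜ +F ⟦ c , e ⟧ᶜ        ∎
    where
    rearrange : ∀ a b c e q → a + c + (b + e) * q ≡ a + b * q + (c + e * q)
    rearrange = solve-∀

  ⊠-homo : ∀ x y → ⟦ x ⊠ y ⟧ᶜ ≡ ⟦ x ⟧ᶜ *F ⟦ y ⟧ᶜ
  ⊠-homo (a , b) (c , e) = begin
    ⟦ normalise (a * c + b * e , a * e + b * c) ⟧ᶜ  ≡⟨ ⟦⟧ᶜ-normalise (a * c + b * e , a * e + b * c) ⟩
    mod (a * c + b * e + (a * e + b * c) * q)       ≡⟨ cong mod (rearrange₁ a b c e q) ⟩
    mod (a * c + (a * e + b * c) * q + b * e)       ≡⟨ mod-+ _ _ ⟩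
    mod (a * c + (a * e + b * c) * q) +F mod (b * e)
      ≡⟨ cong (mod (a * c + (a * e + b * c) * q) +F_) (sym (mod-*q*q (b * e))) ⟩
    mod (a * c + (a * e + b * c) * q) +F mod (b * e * q * q) ≡⟨ sym (mod-+ _ _) ⟩
    mod (a * c + (a * e + b * c) * q + b * e * q * q)  ≡⟨ cong mod (rearrange₂ a b c e q) ⟩
    mod ((a + b * q) * (c + e * q))                  ≡⟨ mod-* _ _ ⟩
    ⟦ a , b ⟧ᶜ *F ⟦ c , e ⟧ᶜ                          ∎
    where
    rearrange₁ : ∀ a b c e q → a * c + b * e + (a * e + b * c) * q ≡ a * c + (a * e + b * c) * q + b * e
    rearrange₁ = solve-∀
    rearrange₂ : ∀ a b c e q → a * c + (a * e + b * c) * q + b * e * q * q ≡ (a + b * q) * (c + e * q)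
    rearrange₂ = solve-∀

  swap-homo : ∀ x → ⟦ swap x ⟧ᶜ ≡ -F ⟦ x ⟧ᶜ
  swap-homo (a , b) = begin
    mod (b + a * q)                 ≡⟨ cong mod (+-comm b (a * q)) ⟩
    mod (a * q + b)                 ≡⟨ mod-+ _ _ ⟩
    mod (a * q) +F mod b            ≡⟨ cong (mod (a * q) +F_) (sym (mod-*q*q b)) ⟩
    mod (a * q) +F mod (b * q * q)  ≡⟨ sym (mod-+ _ _) ⟩
    mod (a * q + b * q * q)         ≡⟨ cong mod (rearrange a b q) ⟩
    mod ((a + b * q) * q)           ≡⟨ mod-*q _ ⟩
    -F ⟦ a , b ⟧ᶜ                   ∎
    where
    rearrange : ∀ a b q → a * q + b * q * q ≡ (a + b * q) * q
    rearrange = solve-∀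

  ⟦⟧ᶜ-homomorphism : Coefficients -Raw-AlmostCommutative⟶ fromCommutativeRing Fp-commutativeRing
  ⟦⟧ᶜ-homomorphism = record
    { ⟦_⟧ = ⟦_⟧ᶜ ; +-homo = ⊞-homo ; *-homo = ⊠-homo ; -‿homo = swap-homo ; 0-homo = refl ; 1-homo = refl }

  _≟ᶜ_ : ∀ x y → Maybe (⟦ x ⟧ᶜ ≡ ⟦ y ⟧ᶜ)
  x ≟ᶜ y with ≡-dec _≟_ _≟_ x y
  ... | yes x≡y = just (cong ⟦_⟧ᶜ x≡y)
  ... | no  _   = nothing

  open import Algebra.Solver.Ring Coefficients (fromCommutativeRing Fp-commutativeRing) ⟦⟧ᶜ-homomorphism _≟ᶜ_
    using (solve; _:=_; con; _:+_; _:*_; _:-_; :-_) public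


module FpField (p : ℕ) {{_ : NonZero p}} (d : Fin p) (p-prime : Prime p) where
  open Setup p d
  open Modulo p
  open FpRing p d
  open ≡-Reasoning

  toℕ-0F : toℕ 0F ≡ 0
  toℕ-0F = trans (toℕ-mod 0) (m*n%n≡0 0 p)

  1F≢0F : 1F ≢ 0F
  1F≢0F 1≡0 = 1+n≢0 (begin
    1       ≡⟨ sym (m<n⇒m%n≡m (nonTrivial⇒n>1 p {{prime⇒nonTrivial p-prime}})) ⟩
    1 % p   ≡⟨ mod≡⇒%≡ 1≡0 ⟩
    0 % p   ≡⟨ m*n%n≡0 0 p ⟩
    0       ∎)

  ∣toℕ⇒≡0F : ∀ a → p ∣ toℕ a → a ≡ 0F
  ∣toℕ⇒≡0F a p∣a = toℕ-injective (begin
    toℕ a      ≡⟨ sym (m<n⇒m%n≡m (toℕ<n a)) ⟩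
    toℕ a % p  ≡⟨ n∣m⇒m%n≡0 (toℕ a) p p∣a ⟩
    0          ≡⟨ sym toℕ-0F ⟩
    toℕ 0F     ∎)

  *F-noZeroDivisors : ∀ a b → a *F b ≡ 0F → a ≡ 0F ⊎ b ≡ 0F
  *F-noZeroDivisors a b ab≡0 with euclidsLemma (toℕ a) (toℕ b) p-prime p∣ab
    where
    p∣ab : p ∣ toℕ a * toℕ b
    p∣ab = m%n≡0⇒n∣m _ p (trans (sym (toℕ-mod _)) (trans (cong toℕ ab≡0) toℕ-0F))
  ... | inj₁ p∣a = inj₁ (∣toℕ⇒≡0F a p∣a)
  ... | inj₂ p∣b = inj₂ (∣toℕ⇒≡0F b p∣b)

  *F-≢0 : ∀ {a b} → a ≢ 0F → b ≢ 0F → a *F b ≢ 0F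
  *F-≢0 {a} {b} a≢0 b≢0 ab≡0 with *F-noZeroDivisors a b ab≡0
  ... | inj₁ a≡0 = a≢0 a≡0
  ... | inj₂ b≡0 = b≢0 b≡0

  *F-cancelˡ : ∀ {b} u v → b ≢ 0F → b *F u ≡ b *F v → u ≡ v
  *F-cancelˡ {b} u v b≢0 bu≡bv = x∙y⁻¹≈ε⇒x≈y u v (u-v≡0 (*F-noZeroDivisors b (u -F v) b[u-v]≡0))
    where
    b[u-v]≡0 : b *F (u -F v) ≡ 0F
    b[u-v]≡0 = trans (x[y-z]≈xy-xz b u v) (x≈y⇒x∙y⁻¹≈ε bu≡bv)
    u-v≡0 : b ≡ 0F ⊎ u -F v ≡ 0F → u -F v ≡ 0F
    u-v≡0 (inj₁ b≡0)   = ⊥-elim (b≢0 b≡0)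
    u-v≡0 (inj₂ u-v≡0) = u-v≡0

module Matrices (p : ℕ) {{_ : NonZero p}} (d : Fin p) where
  open Setup p d
  open FpRing p d

  infixl 7 _⊗_

  _⊗_ : Mat → Mat → Mat
  (a , b , c , e) ⊗ (a′ , b′ , c′ , e′) =
    ((a *F a′) +F (b *F c′)) , ((a *F b′) +F (b *F e′)) , ((c *F a′) +F (e *F c′)) , ((c *F b′) +F (e *F e′))

  Iₘ : Mat
  Iₘ = 1F , 0F , 0F , 1F

  _^ₘ_ : Mat → ℕ → Mat
  M ^ₘ zero  = Iₘ
  M ^ₘ suc n = M ⊗ (M ^ₘ n)

  _·ₘ_ : Fp → Mat → Mat
  k ·ₘ (a , b , c , e) = (k *F a) , (k *F b) , (k *F c) , (k *F e)

  adj : Mat → Mat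
  adj (a , b , c , e) = e , (-F b) , (-F c) , a

  linear : Fp → Fp → Mat → Mat
  linear c y (a , b , c′ , e) = (c +F (y *F a)) , (y *F b) , (y *F c′) , (c +F (y *F e))

  Mat-≡ : ∀ {a b c e a′ b′ c′ e′} → a ≡ a′ → b ≡ b′ → c ≡ c′ → e ≡ e′ →
          _≡_ {A = Mat} (a , b , c , e) (a′ , b′ , c′ , e′)
  Mat-≡ refl refl refl refl = refl

  row-scale : ∀ a b k x y → (a *F (k *F x)) +F (b *F (k *F y)) ≡ k *F ((a *F x) +F (b *F y))
  row-scale = solve 5 (λ a b k x y → a :* (k :* x) :+ b :* (k :* y) := k :* (a :* x :+ b :* y)) refl

  row-assoc : ∀ a b a′ b′ c′ e′ x y →
    (((a *F a′) +F (b *F c′)) *F x) +F (((a *F b′) +F (b *F e′)) *F y)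
      ≡ (a *F ((a′ *F x) +F (b′ *F y))) +F (b *F ((c′ *F x) +F (e′ *F y)))
  row-assoc = solve 8 (λ a b a′ b′ c′ e′ x y →
    (a :* a′ :+ b :* c′) :* x :+ (a :* b′ :+ b :* e′) :* y := a :* (a′ :* x :+ b′ :* y) :+ b :* (c′ :* x :+ e′ :* y)) refl

  act-⊗ : ∀ A B v → act (A ⊗ B) v ≡ act A (act B v)
  act-⊗ (a , b , c , e) (a′ , b′ , c′ , e′) (x , y) =
    cong₂ _,_ (row-assoc a b a′ b′ c′ e′ x y) (row-assoc c e a′ b′ c′ e′ x y)

  act-Iₘ : ∀ v → act Iₘ v ≡ v
  act-Iₘ (x , y) = cong₂ _,_
    (solve 2 (λ x y → con (1 , 0) :* x :+ con (0 , 0) :* y := x) refl x y)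
    (solve 2 (λ x y → con (0 , 0) :* x :+ con (1 , 0) :* y := y) refl x y)

  act-• : ∀ M k v → act M (k • v) ≡ k • act M v
  act-• (a , b , c , e) k (x , y) = cong₂ _,_ (row-scale a b k x y) (row-scale c e k x y)

  act-0V : ∀ M → act M 0V ≡ 0V
  act-0V (a , b , c , e) = cong₂ _,_ (row-0 a b) (row-0 c e)
    where
    row-0 : ∀ a b → (a *F 0F) +F (b *F 0F) ≡ 0F
    row-0 = solve 2 (λ a b → a :* con (0 , 0) :+ b :* con (0 , 0) := con (0 , 0)) refl

  act-adj : ∀ M v → act (adj M) (act M v) ≡ det M • v
  act-adj (a , b , c , e) (x , y) = cong₂ _,_
    (solve 6 (λ a b c e x y → e :* (a :* x :+ b :* y) :+ (:- b) :* (c :* x :+ e :* y)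
                                := (a :* e :- b :* c) :* x) refl a b c e x y)
    (solve 6 (λ a b c e x y → (:- c) :* (a :* x :+ b :* y) :+ a :* (c :* x :+ e :* y)
                                := (a :* e :- b :* c) :* y) refl a b c e x y)

  det-⊗ : ∀ A B → det (A ⊗ B) ≡ det A *F det B
  det-⊗ (a , b , c , e) (a′ , b′ , c′ , e′) = solve 8 (λ a b c e a′ b′ c′ e′ →
    (a :* a′ :+ b :* c′) :* (c :* b′ :+ e :* e′) :- (a :* b′ :+ b :* e′) :* (c :* a′ :+ e :* c′)
      := (a :* e :- b :* c) :* (a′ :* e′ :- b′ :* c′)) refl a b c e a′ b′ c′ e′

  det-Iₘ : det Iₘ ≡ 1F
  det-Iₘ = solve 0 (con (1 , 0) :* con (1 , 0) :- con (0 , 0) :* con (0 , 0) := con (1 , 0)) refl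

  ⊗-·ₘ : ∀ A k B → A ⊗ (k ·ₘ B) ≡ k ·ₘ (A ⊗ B)
  ⊗-·ₘ (a , b , c , e) k (a′ , b′ , c′ , e′) =
    Mat-≡ (row-scale a b k a′ c′) (row-scale a b k b′ e′) (row-scale c e k a′ c′) (row-scale c e k b′ e′)

  -- Cayley–Hamilton: M² = tr M · M − det M · I.
  ⊗-linear : ∀ M c y → M ⊗ linear c y M ≡ linear (-F (y *F det M)) (c +F (y *F tr M)) M
  ⊗-linear (a , b , c′ , e) c y = Mat-≡
    (solve 6 (λ a b c′ e c y → a :* (c :+ y :* a) :+ b :* (y :* c′)
                                 := :- (y :* (a :* e :- b :* c′)) :+ (c :+ y :* (a :+ e)) :* a) refl a b c′ e c y)
    (solve 6 (λ a b c′ e c y → a :* (y :* b) :+ b :* (c :+ y :* e) := (c :+ y :* (a :+ e)) :* b) refl a b c′ e c y)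
    (solve 6 (λ a b c′ e c y → c′ :* (c :+ y :* a) :+ e :* (y :* c′) := (c :+ y :* (a :+ e)) :* c′) refl a b c′ e c y)
    (solve 6 (λ a b c′ e c y → c′ :* (y :* b) :+ e :* (c :+ y :* e)
                                 := :- (y :* (a :* e :- b :* c′)) :+ (c :+ y :* (a :+ e)) :* e) refl a b c′ e c y)

  tr-linear : ∀ c y M → tr (linear c y M) ≡ (c +F c) +F (y *F tr M)
  tr-linear c y (a , _ , _ , e) =
    solve 4 (λ c y a e → (c :+ y :* a) :+ (c :+ y :* e) := (c :+ c) :+ y :* (a :+ e)) refl c y a e

  det-linear : ∀ c y M → det (linear c y M) ≡ ((c *F c) +F ((c *F y) *F tr M)) +F ((y *F y) *F det M)
  det-linear c y (a , b , c′ , e) = solve 6 (λ c y a b c′ e →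
    (c :+ y :* a) :* (c :+ y :* e) :- (y :* b) :* (y :* c′)
      := (c :* c :+ (c :* y) :* (a :+ e)) :+ (y :* y) :* (a :* e :- b :* c′)) refl c y a b c′ e

  tr-·ₘ : ∀ k M → tr (k ·ₘ M) ≡ k *F tr M
  tr-·ₘ k (a , _ , _ , e) = sym (*F-distribˡ-+F k a e)

  det-·ₘ : ∀ k M → det (k ·ₘ M) ≡ (k *F k) *F det M
  det-·ₘ k (a , b , c , e) =
    solve 5 (λ k a b c e → (k :* a) :* (k :* e) :- (k :* b) :* (k :* c) := (k :* k) :* (a :* e :- b :* c)) refl k a b c e

  ·ₘ-Iₘ : ∀ k M → k ·ₘ Iₘ ≡ linear k 0F M
  ·ₘ-Iₘ k (a , b , c , e) = Mat-≡ (diagonal k a) (off-diagonal k b) (off-diagonal k c) (diagonal k e)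
    where
    diagonal : ∀ k a → k *F 1F ≡ k +F (0F *F a)
    diagonal = solve 2 (λ k a → k :* con (1 , 0) := k :+ con (0 , 0) :* a) refl
    off-diagonal : ∀ k b → k *F 0F ≡ 0F *F b
    off-diagonal = solve 2 (λ k b → k :* con (0 , 0) := con (0 , 0) :* b) refl

module InvertibleMatrices (p : ℕ) {{_ : NonZero p}} (d : Fin p) (p-prime : Prime p) where
  open Setup p d
  open FpRing p d
  open FpField p d p-prime
  open Matrices p d

  •-cancelˡ : ∀ {k} u v → k ≢ 0F → k • u ≡ k • v → u ≡ v
  •-cancelˡ (x , y) (x′ , y′) k≢0 ku≡kv =
    cong₂ _,_ (*F-cancelˡ x x′ k≢0 (cong proj₁ ku≡kv)) (*F-cancelˡ y y′ k≢0 (cong proj₂ ku≡kv))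

  act-injective : ∀ {M} u v → det M ≢ 0F → act M u ≡ act M v → u ≡ v
  act-injective {M} u v detM≢0 Mu≡Mv = •-cancelˡ u v detM≢0 (begin
    det M • u                  ≡⟨ sym (act-adj M u) ⟩
    act (adj M) (act M u)      ≡⟨ cong (act (adj M)) Mu≡Mv ⟩
    act (adj M) (act M v)      ≡⟨ act-adj M v ⟩
    det M • v                  ∎)
    where open ≡-Reasoning

  det-^ₘ≢0 : ∀ {M} n → det M ≢ 0F → det (M ^ₘ n) ≢ 0F
  det-^ₘ≢0     zero    _      det≡0 = 1F≢0F (trans (sym det-Iₘ) det≡0)
  det-^ₘ≢0 {M} (suc n) detM≢0 det≡0 =
    *F-≢0 detM≢0 (det-^ₘ≢0 n detM≢0) (trans (sym (det-⊗ M (M ^ₘ n))) det≡0)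

  ·ₘ-cancelˡ : ∀ {k} A B → k ≢ 0F → k ·ₘ A ≡ k ·ₘ B → A ≡ B
  ·ₘ-cancelˡ (a , b , c , e) (a′ , b′ , c′ , e′) k≢0 kA≡kB = Mat-≡
    (*F-cancelˡ a a′ k≢0 (cong proj₁ kA≡kB))
    (*F-cancelˡ b b′ k≢0 (cong (proj₁ ∘ proj₂) kA≡kB))
    (*F-cancelˡ c c′ k≢0 (cong (proj₁ ∘ proj₂ ∘ proj₂) kA≡kB))
    (*F-cancelˡ e e′ k≢0 (cong (proj₂ ∘ proj₂ ∘ proj₂) kA≡kB))

module QuadraticExtension (p : ℕ) {{_ : NonZero p}} (d : Fin p) where
  open Setup p d
  open FpRing p d

  *F2-assoc : Associative _≡_ _*F2_
  *F2-assoc (a , b) (c , e) (f , g) = cong₂ _,_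
    (solve 7 (λ a b c e f g d → (a :* c :+ d :* (b :* e)) :* f :+ d :* ((a :* e :+ b :* c) :* g)
                                  := a :* (c :* f :+ d :* (e :* g)) :+ d :* (b :* (c :* g :+ e :* f))) refl a b c e f g d)
    (solve 7 (λ a b c e f g d → (a :* c :+ d :* (b :* e)) :* g :+ (a :* e :+ b :* c) :* f
                                  := a :* (c :* g :+ e :* f) :+ b :* (c :* f :+ d :* (e :* g))) refl a b c e f g d)

  *F2-identity : Identity _≡_ 1F2 _*F2_
  *F2-identity = identityˡ , identityʳ
    where
    identityˡ : LeftIdentity _≡_ 1F2 _*F2_
    identityˡ (a , b) = cong₂ _,_
      (solve 3 (λ a b d → con (1 , 0) :* a :+ d :* (con (0 , 0) :* b) := a) refl a b d)
      (solve 2 (λ a b → con (1 , 0) :* b :+ con (0 , 0) :* a := b) refl a b)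
    identityʳ : RightIdentity _≡_ 1F2 _*F2_
    identityʳ (a , b) = cong₂ _,_
      (solve 3 (λ a b d → a :* con (1 , 0) :+ d :* (b :* con (0 , 0)) := a) refl a b d)
      (solve 2 (λ a b → a :* con (0 , 0) :+ b :* con (1 , 0) := b) refl a b)

  pow-+ : ∀ x m n → pow x (m + n) ≡ pow x m *F2 pow x n
  pow-+ x zero    n = sym (proj₁ *F2-identity (pow x n))
  pow-+ x (suc m) n = trans (cong (x *F2_) (pow-+ x m n)) (sym (*F2-assoc x (pow x m) (pow x n)))

  pow-* : ∀ x m n → pow x (m * n) ≡ pow (pow x n) m
  pow-* x zero    n = refl
  pow-* x (suc m) n = trans (pow-+ x n (m * n)) (cong (pow x n *F2_) (pow-* x m n))

  pow-1 : ∀ x → pow x 1 ≡ x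
  pow-1 x = proj₂ *F2-identity x

  pow-snd≡0 : ∀ a n → proj₂ (pow (a , 0F) n) ≡ 0F
  pow-snd≡0 a zero    = refl
  pow-snd≡0 a (suc n) = begin
    (a *F proj₂ (pow (a , 0F) n)) +F (0F *F x)  ≡⟨ cong (λ y → (a *F y) +F (0F *F x)) (pow-snd≡0 a n) ⟩
    (a *F 0F) +F (0F *F x)                      ≡⟨ solve 2 (λ a x → a :* con (0 , 0) :+ con (0 , 0) :* x := con (0 , 0)) refl a x ⟩
    0F                                          ∎
    where
    open ≡-Reasoning
    x : Fp
    x = proj₁ (pow (a , 0F) n)

  trace norm : Fp2 → Fp
  trace (a , b) = a +F a
  norm  (a , b) = (a *F a) -F (d *F (b *F b))

module CayleyHamilton (p : ℕ) {{_ : NonZero p}} (d : Fin p) (p-prime : Prime p) where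
  open Setup p d
  open FpRing p d
  open FpField p d p-prime
  open Matrices p d
  open InvertibleMatrices p d p-prime
  open QuadraticExtension p d
  open ≡-Reasoning

  minpoly-irrational : ∀ {a b} → b ≢ 0F → minpoly (a , b) ≡ norm (a , b) ∷ (-F trace (a , b)) ∷ 1F ∷ []
  minpoly-irrational {a} {b} b≢0 with b ≟F 0F
  ... | yes b≡0 = ⊥-elim (b≢0 b≡0)
  ... | no  _   = refl

  InClass⇒tr : ∀ {γ M} → proj₂ γ ≢ 0F → InClass γ M → tr M ≡ trace γ
  InClass⇒tr b≢0 (_ , χ≡μ) =
    -‿injective (proj₁ (∷-injective (proj₂ (∷-injective (trans χ≡μ (minpoly-irrational b≢0))))))

  InClass⇒det : ∀ {γ M} → proj₂ γ ≢ 0F → InClass γ M → det M ≡ norm γ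
  InClass⇒det b≢0 (_ , χ≡μ) = proj₁ (∷-injective (trans χ≡μ (minpoly-irrational b≢0)))

  InClass-intro : ∀ {γ M} → proj₂ γ ≢ 0F → det M ≢ 0F → tr M ≡ trace γ → det M ≡ norm γ → InClass γ M
  InClass-intro b≢0 det≢0 tr≡ det≡ =
    det≢0 , trans (cong₂ (λ t n → n ∷ (-F t) ∷ 1F ∷ []) tr≡ det≡) (sym (minpoly-irrational b≢0))

  -- For γ = a + b√d with b ≠ 0 and M with the characteristic polynomial of γ,
  -- u ↦ ρ u / b is the F_p-algebra map F_p[√d] → Mat sending √d to (M − a I) / b, hence γ to M.
  module _ (a b : Fp) (M : Mat) where

    ρ : Fp2 → Mat
    ρ (x , y) = linear ((b *F x) -F (a *F y)) y M

    module _ (trM : tr M ≡ trace (a , b)) (detM : det M ≡ norm (a , b)) where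

      ⊗-ρ : ∀ u → M ⊗ ρ u ≡ ρ ((a , b) *F2 u)
      ⊗-ρ (x , y) = begin
        M ⊗ linear c y M                                    ≡⟨ ⊗-linear M c y ⟩
        linear (-F (y *F det M)) (c +F (y *F tr M)) M
          ≡⟨ cong₂ (λ n t → linear (-F (y *F n)) (c +F (y *F t)) M) detM trM ⟩
        linear (-F (y *F norm (a , b))) (c +F (y *F (a +F a))) M
          ≡⟨ cong₂ (λ c′ y′ → linear c′ y′ M)
               (solve 5 (λ a b d x y → :- (y :* (a :* a :- d :* (b :* b)))
                                         := b :* (a :* x :+ d :* (b :* y)) :- a :* (a :* y :+ b :* x)) refl a b d x y)
               (solve 4 (λ a b x y → (b :* x :- a :* y) :+ y :* (a :+ a) := a :* y :+ b :* x) refl a b x y) ⟩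
        ρ ((a , b) *F2 (x , y))                              ∎
        where
        c : Fp
        c = (b *F x) -F (a *F y)

      ·ₘ-^ₘ≡ρ-pow : ∀ n → b ·ₘ (M ^ₘ n) ≡ ρ (pow (a , b) n)
      ·ₘ-^ₘ≡ρ-pow zero    = trans (·ₘ-Iₘ b M) (cong (λ c → linear c 0F M)
        (solve 2 (λ a b → b := b :* con (1 , 0) :- a :* con (0 , 0)) refl a b))
      ·ₘ-^ₘ≡ρ-pow (suc n) = begin
        b ·ₘ (M ⊗ (M ^ₘ n))   ≡⟨ sym (⊗-·ₘ M b (M ^ₘ n)) ⟩
        M ⊗ (b ·ₘ (M ^ₘ n))   ≡⟨ cong (M ⊗_) (·ₘ-^ₘ≡ρ-pow n) ⟩
        M ⊗ ρ (pow (a , b) n) ≡⟨ ⊗-ρ (pow (a , b) n) ⟩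
        ρ (pow (a , b) (suc n)) ∎

      module _ (b≢0 : b ≢ 0F) {X : Mat} (u : Fp2) (bX≡ρu : b ·ₘ X ≡ ρ u) where
        private
          x y c : Fp
          x = proj₁ u
          y = proj₂ u
          c = (b *F x) -F (a *F y)

        ρ-tr : tr X ≡ trace u
        ρ-tr = *F-cancelˡ (tr X) (trace u) b≢0 (begin
          b *F tr X                       ≡⟨ sym (tr-·ₘ b X) ⟩
          tr (b ·ₘ X)                     ≡⟨ cong tr bX≡ρu ⟩
          tr (ρ u)                        ≡⟨ tr-linear c y M ⟩
          (c +F c) +F (y *F tr M)         ≡⟨ cong (λ t → (c +F c) +F (y *F t)) trM ⟩
          (c +F c) +F (y *F (a +F a))
            ≡⟨ solve 4 (λ a b x y → ((b :* x :- a :* y) :+ (b :* x :- a :* y)) :+ y :* (a :+ a)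
                                      := b :* (x :+ x)) refl a b x y ⟩
          b *F trace u                    ∎)

        ρ-det : det X ≡ norm u
        ρ-det = *F-cancelˡ (det X) (norm u) (*F-≢0 b≢0 b≢0) (begin
          (b *F b) *F det X                                        ≡⟨ sym (det-·ₘ b X) ⟩
          det (b ·ₘ X)                                             ≡⟨ cong det bX≡ρu ⟩
          det (ρ u)                                                ≡⟨ det-linear c y M ⟩
          ((c *F c) +F ((c *F y) *F tr M)) +F ((y *F y) *F det M)
            ≡⟨ cong₂ (λ t n → ((c *F c) +F ((c *F y) *F t)) +F ((y *F y) *F n)) trM detM ⟩
          ((c *F c) +F ((c *F y) *F (a +F a))) +F ((y *F y) *F norm (a , b))
            ≡⟨ solve 5 (λ a b d x y →
                 ((b :* x :- a :* y) :* (b :* x :- a :* y) :+ ((b :* x :- a :* y) :* y) :* (a :+ a))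
                   :+ (y :* y) :* (a :* a :- d :* (b :* b))
                 := (b :* b) :* (x :* x :- d :* (y :* y))) refl a b d x y ⟩
          (b *F b) *F norm u                                       ∎)

  ^ₘ-InClass : ∀ {γ} M n → proj₂ γ ≢ 0F → InClass γ M → proj₂ (pow γ n) ≢ 0F → InClass (pow γ n) (M ^ₘ n)
  ^ₘ-InClass {a , b} M n b≢0 M∈𝒞 bₙ≢0 = InClass-intro {M = M ^ₘ n} bₙ≢0 (det-^ₘ≢0 n (proj₁ M∈𝒞))
    (ρ-tr a b M trM detM b≢0 {M ^ₘ n} (pow (a , b) n) bMⁿ≡ρ)
    (ρ-det a b M trM detM b≢0 {M ^ₘ n} (pow (a , b) n) bMⁿ≡ρ)
    where
    trM : tr M ≡ trace (a , b)
    trM = InClass⇒tr {M = M} b≢0 M∈𝒞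
    detM : det M ≡ norm (a , b)
    detM = InClass⇒det {M = M} b≢0 M∈𝒞
    bMⁿ≡ρ : b ·ₘ (M ^ₘ n) ≡ ρ a b M (pow (a , b) n)
    bMⁿ≡ρ = ·ₘ-^ₘ≡ρ-pow a b M trM detM n

  pow≡⇒^ₘ≡ : ∀ {γ} M m n → proj₂ γ ≢ 0F → InClass γ M → pow γ m ≡ pow γ n → M ^ₘ m ≡ M ^ₘ n
  pow≡⇒^ₘ≡ {a , b} M m n b≢0 M∈𝒞 γᵐ≡γⁿ = ·ₘ-cancelˡ (M ^ₘ m) (M ^ₘ n) b≢0 (begin
    b ·ₘ (M ^ₘ m)      ≡⟨ ·ₘ-^ₘ≡ρ-pow a b M trM detM m ⟩
    ρ′ (pow (a , b) m) ≡⟨ cong ρ′ γᵐ≡γⁿ ⟩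
    ρ′ (pow (a , b) n) ≡⟨ sym (·ₘ-^ₘ≡ρ-pow a b M trM detM n) ⟩
    b ·ₘ (M ^ₘ n)      ∎)
    where
    trM : tr M ≡ trace (a , b)
    trM = InClass⇒tr {M = M} b≢0 M∈𝒞
    detM : det M ≡ norm (a , b)
    detM = InClass⇒det {M = M} b≢0 M∈𝒞
    ρ′ : Fp2 → Mat
    ρ′ = ρ a b M

module CyclicSubgroups (p : ℕ) {{_ : NonZero p}} (d : Fin p) (p-prime : Prime p) where
  open Setup p d
  open Matrices p d
  open InvertibleMatrices p d p-prime

  _≟V_ : DecidableEquality V
  _≟V_ = ≡-dec _≟F_ _≟F_

  ≈S-by : ∀ {C D} → (∀ w → C w ≡ true → D w ≡ true) → (∀ w → D w ≡ true → C w ≡ true) → C ≈S D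
  ≈S-by C⊆D D⊆C w = ⇔→≡ (mk⇔ (C⊆D w) (D⊆C w))

  MapsOnto-⊗ : ∀ A B {C D E} → MapsOnto A C D → MapsOnto B D E → MapsOnto (B ⊗ A) C E
  MapsOnto-⊗ A B {C} {D} {E} A[C]≡D B[D]≡E w = into , onto
    where
    into : E w ≡ true → Σ V λ v → (C v ≡ true) × (act (B ⊗ A) v ≡ w)
    into Ew with proj₁ (B[D]≡E w) Ew
    ... | u , Du , Bu≡w with proj₁ (A[C]≡D u) Du
    ... | v , Cv , Av≡u = v , Cv , trans (act-⊗ B A v) (trans (cong (act B) Av≡u) Bu≡w)
    onto : (Σ V λ v → (C v ≡ true) × (act (B ⊗ A) v ≡ w)) → E w ≡ true
    onto (v , Cv , BAv≡w) =
      proj₂ (B[D]≡E w) (act A v , proj₂ (A[C]≡D (act A v)) (v , Cv , refl) , trans (sym (act-⊗ B A v)) BAv≡w)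

  MapsOnto-Iₘ : ∀ C → MapsOnto Iₘ C C
  MapsOnto-Iₘ C w =
    (λ Cw → w , Cw , act-Iₘ w) , λ { (v , Cv , v≡w) → subst (λ u → C u ≡ true) (trans (sym (act-Iₘ v)) v≡w) Cv }

  MapsOnto-unique : ∀ A {C D D′} → MapsOnto A C D → MapsOnto A C D′ → D ≈S D′
  MapsOnto-unique A A[C]≡D A[C]≡D′ =
    ≈S-by (λ w Dw → proj₂ (A[C]≡D′ w) (proj₁ (A[C]≡D w) Dw))
          (λ w D′w → proj₂ (A[C]≡D w) (proj₁ (A[C]≡D′ w) D′w))

  MapsOnto-≈S : ∀ A {C D D′} → MapsOnto A C D → D ≈S D′ → MapsOnto A C D′
  MapsOnto-≈S A A[C]≡D D≈D′ w =
    (λ D′w → proj₁ (A[C]≡D w) (trans (D≈D′ w) D′w)) , (λ v → trans (sym (D≈D′ w)) (proj₂ (A[C]≡D w) v))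

  MapsOnto-injective : ∀ A {C C′ D} → det A ≢ 0F → MapsOnto A C D → MapsOnto A C′ D → C ≈S C′
  MapsOnto-injective A {D = D} detA≢0 A[C]≡D A[C′]≡D = ≈S-by (⊆ A[C]≡D A[C′]≡D) (⊆ A[C′]≡D A[C]≡D)
    where
    ⊆ : ∀ {X Y} → MapsOnto A X D → MapsOnto A Y D → ∀ v → X v ≡ true → Y v ≡ true
    ⊆ {Y = Y} A[X]≡D A[Y]≡D v Xv with proj₁ (A[Y]≡D (act A v)) (proj₂ (A[X]≡D (act A v)) (v , Xv , refl))
    ... | v′ , Yv′ , Av′≡Av = subst (λ u → Y u ≡ true) (act-injective {A} v′ v detA≢0 Av′≡Av) Yv′

  image-IsCyclicP : ∀ A {C} → det A ≢ 0F → IsCyclicP C → Σ Sub λ D → IsCyclicP D × MapsOnto A C D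
  image-IsCyclicP A {C} detA≢0 (v , v≢0 , C≡⟨v⟩) = D , (act A v , Av≢0 , D≡⟨Av⟩) , A[C]≡D
    where
    ⟨Av⟩? : ∀ w → Dec (∃ λ c → w ≡ c • act A v)
    ⟨Av⟩? w = any? (λ c → w ≟V (c • act A v))
    D : Sub
    D w = isYes (⟨Av⟩? w)
    D≡⟨Av⟩ : ∀ w → (D w ≡ true) ↔′ (∃ λ c → w ≡ c • act A v)
    D≡⟨Av⟩ w =
      (λ Dw → toWitness (Equivalence.from T-≡ Dw)) , (λ w∈⟨Av⟩ → Equivalence.to T-≡ (fromWitness w∈⟨Av⟩))
    Av≢0 : act A v ≢ 0V
    Av≢0 Av≡0 = v≢0 (act-injective {A} v 0V detA≢0 (trans Av≡0 (sym (act-0V A))))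
    A[C]≡D : MapsOnto A C D
    A[C]≡D w = into , onto
      where
      into : D w ≡ true → Σ V λ u → (C u ≡ true) × (act A u ≡ w)
      into Dw with proj₁ (D≡⟨Av⟩ w) Dw
      ... | c , w≡cAv = c • v , proj₂ (C≡⟨v⟩ (c • v)) (c , refl) , trans (act-• A c v) (sym w≡cAv)
      onto : (Σ V λ u → (C u ≡ true) × (act A u ≡ w)) → D w ≡ true
      onto (u , Cu , Au≡w) with proj₁ (C≡⟨v⟩ u) Cu
      ... | c , u≡cv = proj₂ (D≡⟨Av⟩ w) (c , trans (sym Au≡w) (trans (cong (act A) u≡cv) (act-• A c v)))

module Necklaces (p : ℕ) {{_ : NonZero p}} (d : Fin p) (p-prime : Prime p) where
  open import Data.Nat.DivMod using (_mod_)
  open Setup p d hiding (mod)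
  open FpField p d p-prime using (1F≢0F)
  open Matrices p d
  open CayleyHamilton p d p-prime
  open QuadraticExtension p d
  open CyclicSubgroups p d p-prime
  open Modulo (suc p)
  open ≡-Reasoning

  [_] : ℕ → Fin (suc p)
  [ n ] = n mod suc p

  [suc]-fromℕ : [ suc (toℕ (fromℕ p)) ] ≡ fzero
  [suc]-fromℕ = toℕ-injective (trans (toℕ-mod (suc (toℕ (fromℕ p)))) (trans (cong (λ n → suc n % suc p) (toℕ-fromℕ p)) (n%n≡0 (suc p))))

  [suc]-inject₁ : ∀ i → [ suc (toℕ (inject₁ i)) ] ≡ fsuc i
  [suc]-inject₁ i = toℕ-injective (trans (toℕ-mod (suc (toℕ (inject₁ i))))
    (trans (cong (λ n → suc n % suc p) (toℕ-inject₁ i)) (m<n⇒m%n≡m (s≤s (toℕ<n i)))))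

  ⊕-identityʳ : ∀ i → i ⊕ fzero ≡ i
  ⊕-identityʳ i = trans (cong [_] (+-identityʳ (toℕ i))) (mod-toℕ i)

  module Necklace {L : Enum} (L-enum : IsEnumeration L) {M : Mat} (detM≢0 : det M ≢ 0F)
                  (M-shifts : ∀ (i : Fin p) → MapsOnto M (L (inject₁ i)) (L (fsuc i))) where

    L-injective : ∀ i j → L i ≈S L j → i ≡ j
    L-injective = proj₁ (proj₂ L-enum)

    -- The image of C_p is some C_k; k ≠ i + 1, as M already maps C_i onto C_(i+1).
    last↦zero : MapsOnto M (L (fromℕ p)) (L fzero)
    last↦zero = onto-zero (proj₁ Lk≈D) (MapsOnto-≈S M M[Cₚ]≡D (λ w → sym (proj₂ Lk≈D w)))
      where
      image : Σ Sub λ D → IsCyclicP D × MapsOnto M (L (fromℕ p)) D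
      image = image-IsCyclicP M detM≢0 (proj₁ L-enum (fromℕ p))
      M[Cₚ]≡D : MapsOnto M (L (fromℕ p)) (proj₁ image)
      M[Cₚ]≡D = proj₂ (proj₂ image)
      Lk≈D : ∃ λ k → L k ≈S proj₁ image
      Lk≈D = proj₂ (proj₂ L-enum) (proj₁ image) (proj₁ (proj₂ image))
      onto-zero : ∀ k → MapsOnto M (L (fromℕ p)) (L k) → MapsOnto M (L (fromℕ p)) (L fzero)
      onto-zero fzero    M[Cₚ]≡C₀ = M[Cₚ]≡C₀
      onto-zero (fsuc i) M[Cₚ]≡Cᵢ₊₁ =
        ⊥-elim (fromℕ≢inject₁ (sym (L-injective _ _ (MapsOnto-injective M detM≢0 (M-shifts i) M[Cₚ]≡Cᵢ₊₁))))

    shift : ∀ k → MapsOnto M (L k) (L [ suc (toℕ k) ])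
    shift k with view k
    ... | ‵fromℕ     = subst (λ j → MapsOnto M (L (fromℕ p)) (L j)) (sym [suc]-fromℕ) last↦zero
    ... | ‵inject₁ i = subst (λ j → MapsOnto M (L (inject₁ i)) (L j)) (sym ([suc]-inject₁ i)) (M-shifts i)

    ^ₘ-shifts : ∀ n r → MapsOnto (M ^ₘ n) (L [ r ]) (L [ r + n ])
    ^ₘ-shifts zero    r =
      subst (λ s → MapsOnto Iₘ (L [ r ]) (L [ s ])) (sym (+-identityʳ r)) (MapsOnto-Iₘ (L [ r ]))
    ^ₘ-shifts (suc n) r = subst (λ s → MapsOnto (M ^ₘ suc n) (L [ r ]) (L s)) [1+[r+n]]≡[r+1+n]
      (MapsOnto-⊗ (M ^ₘ n) M (^ₘ-shifts n r) (shift [ r + n ]))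
      where
      [1+[r+n]]≡[r+1+n] : [ suc (toℕ [ r + n ]) ] ≡ [ r + suc n ]
      [1+[r+n]]≡[r+1+n] = trans (mod-+-toℕ 1 (r + n)) (cong [_] (sym (+-suc r n)))

    ^ₘ≡M⇒≡1 : ∀ N → M ^ₘ N ≡ M ^ₘ 1 → [ N ] ≡ [ 1 ]
    ^ₘ≡M⇒≡1 N Mᴺ≡M = L-injective [ N ] [ 1 ] (MapsOnto-unique (M ^ₘ 1) M[C₀]≡C_N (^ₘ-shifts 1 0))
      where
      M[C₀]≡C_N : MapsOnto (M ^ₘ 1) (L [ 0 ]) (L [ N ])
      M[C₀]≡C_N = subst (λ A → MapsOnto A (L [ 0 ]) (L [ N ])) Mᴺ≡M (^ₘ-shifts N 0)

  IsGenerator⇒snd≢0 : ∀ {γ} → IsGenerator γ → proj₂ γ ≢ 0F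
  IsGenerator⇒snd≢0 {a , b} γ-gen b≡0 =
    let n , γⁿ≡√d = γ-gen (0F , 1F) (λ √d≡0 → 1F≢0F (cong proj₂ √d≡0)) in
    1F≢0F (begin
      1F                       ≡⟨ cong proj₂ (sym γⁿ≡√d) ⟩
      proj₂ (pow (a , b) n)    ≡⟨ cong (λ b → proj₂ (pow (a , b) n)) b≡0 ⟩
      proj₂ (pow (a , 0F) n)   ≡⟨ pow-snd≡0 a n ⟩
      0F                       ∎)

  IsGenerator⇒≢0F2 : ∀ {γ} → IsGenerator γ → γ ≢ 0F2
  IsGenerator⇒≢0F2 γ-gen γ≡0 = IsGenerator⇒snd≢0 γ-gen (cong proj₂ γ≡0)

  reindex : ℕ → Enum → Enum
  reindex j L i = L [ j * toℕ i ]

  [*]-inverse : ∀ u v → [ u * v ] ≡ [ 1 ] → ∀ i → [ v * toℕ [ u * toℕ i ] ] ≡ i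
  [*]-inverse u v [uv]≡1 i = begin
    [ v * toℕ [ u * toℕ i ] ]  ≡⟨ mod-*-toℕ v (u * toℕ i) ⟩
    [ v * (u * toℕ i) ]        ≡⟨ cong [_] (rearrange u v (toℕ i)) ⟩
    [ toℕ i * (u * v) ]        ≡⟨ sym (mod-*-toℕ (toℕ i) (u * v)) ⟩
    [ toℕ i * toℕ [ u * v ] ]  ≡⟨ cong (λ k → [ toℕ i * toℕ k ]) [uv]≡1 ⟩
    [ toℕ i * toℕ [ 1 ] ]      ≡⟨ mod-*-toℕ (toℕ i) 1 ⟩
    [ toℕ i * 1 ]              ≡⟨ cong [_] (*-identityʳ (toℕ i)) ⟩
    [ toℕ i ]                  ≡⟨ mod-toℕ i ⟩
    i                          ∎
    where
    rearrange : ∀ u v i → v * (u * i) ≡ i * (u * v)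
    rearrange = solve-∀

  [*]-⊕ : ∀ j i k → [ j * toℕ (i ⊕ k) ] ≡ [ j * toℕ i ] ⊕ [ j * toℕ k ]
  [*]-⊕ j i k = begin
    [ j * toℕ [ toℕ i + toℕ k ] ]  ≡⟨ mod-*-toℕ j (toℕ i + toℕ k) ⟩
    [ j * (toℕ i + toℕ k) ]        ≡⟨ cong [_] (*-distribˡ-+ j (toℕ i) (toℕ k)) ⟩
    [ j * toℕ i + j * toℕ k ]      ≡⟨ mod-+ (j * toℕ i) (j * toℕ k) ⟩
    [ j * toℕ i ] ⊕ [ j * toℕ k ]  ∎

  reindex-inverse : ∀ u v → [ u * v ] ≡ [ 1 ] → ∀ L → reindex u (reindex v L) ~ L
  reindex-inverse u v [uv]≡1 L = fzero , λ i w →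
    cong (λ k → L k w) (sym (trans ([*]-inverse u v [uv]≡1 (i ⊕ fzero)) (⊕-identityʳ i)))

  reindex-resp-~ : ∀ j m {L L′} → [ m * j ] ≡ [ 1 ] → L ~ L′ → reindex j L ~ reindex j L′
  reindex-resp-~ j m {L} [mj]≡1 (k , L′≈L[+k]) = [ m * toℕ k ] , λ i w →
    trans (L′≈L[+k] [ j * toℕ i ] w) (cong (λ t → L t w) (sym (begin
      [ j * toℕ (i ⊕ [ m * toℕ k ]) ]                ≡⟨ [*]-⊕ j i [ m * toℕ k ] ⟩
      [ j * toℕ i ] ⊕ [ j * toℕ [ m * toℕ k ] ]      ≡⟨ cong ([ j * toℕ i ] ⊕_) ([*]-inverse m j [mj]≡1 k) ⟩
      [ j * toℕ i ] ⊕ k                              ∎)))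

  reindex-IsEnumeration : ∀ j m {L} → [ m * j ] ≡ [ 1 ] → IsEnumeration L → IsEnumeration (reindex j L)
  reindex-IsEnumeration j m {L} [mj]≡1 (L-cyclic , L-injective , L-surjective) =
    (λ i → L-cyclic [ j * toℕ i ]) , injective , surjective
    where
    [jm]≡1 : [ j * m ] ≡ [ 1 ]
    [jm]≡1 = trans (cong [_] (*-comm j m)) [mj]≡1
    injective : ∀ i i′ → reindex j L i ≈S reindex j L i′ → i ≡ i′
    injective i i′ Lji≈Lji′ = begin
      i                            ≡⟨ sym ([*]-inverse j m [jm]≡1 i) ⟩
      [ m * toℕ [ j * toℕ i ] ]    ≡⟨ cong (λ k → [ m * toℕ k ]) (L-injective _ _ Lji≈Lji′) ⟩
      [ m * toℕ [ j * toℕ i′ ] ]   ≡⟨ [*]-inverse j m [jm]≡1 i′ ⟩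
      i′                           ∎
    surjective : ∀ C → IsCyclicP C → ∃ λ i → reindex j L i ≈S C
    surjective C C-cyclic =
      let k , Lk≈C = L-surjective C C-cyclic in
      [ m * toℕ k ] , λ w → trans (cong (λ t → L t w) ([*]-inverse m j [mj]≡1 k)) (Lk≈C w)

  reindex-equivariant : ∀ γ j → Equivariant γ (reindex j)
  reindex-equivariant γ j g L L′ _ _ _ g[L]≡L′ = fzero , λ i →
    subst (λ k → MapsOnto g (reindex j L i) (reindex j L′ k)) (sym (⊕-identityʳ i)) (g[L]≡L′ [ j * toℕ i ])

  module Transfer {γ γ′ : Fp2} (γ-gen : IsGenerator γ) (γ′-gen : IsGenerator γ′)
                  {j m : ℕ} (γʲ≡γ′ : pow γ j ≡ γ′) (γ′ᵐ≡γ : pow γ′ m ≡ γ) where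

    γᵐʲ≡γ : pow γ (m * j) ≡ pow γ 1
    γᵐʲ≡γ = begin
      pow γ (m * j)    ≡⟨ pow-* γ m j ⟩
      pow (pow γ j) m  ≡⟨ cong (λ x → pow x m) γʲ≡γ′ ⟩
      pow γ′ m         ≡⟨ γ′ᵐ≡γ ⟩
      γ                ≡⟨ sym (pow-1 γ) ⟩
      pow γ 1          ∎

    -- h^(m j) = h, while h^n moves C_0 to C_n; so m j ≡ 1 mod p + 1.
    [m*j]≡1 : ∀ {L} → IsNecklace γ L → [ m * j ] ≡ [ 1 ]
    [m*j]≡1 (L-enum , M , M∈𝒞 , M-shifts) = Necklace.^ₘ≡M⇒≡1 L-enum (proj₁ M∈𝒞) M-shifts (m * j)
      (pow≡⇒^ₘ≡ M (m * j) 1 (IsGenerator⇒snd≢0 γ-gen) M∈𝒞 γᵐʲ≡γ)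

    reindex-IsNecklace : ∀ L → IsNecklace γ L → IsNecklace γ′ (reindex j L)
    reindex-IsNecklace L L-neck@(L-enum , M , M∈𝒞 , M-shifts) =
      reindex-IsEnumeration j m ([m*j]≡1 L-neck) L-enum , M ^ₘ j , Mʲ∈𝒞 , Mʲ-shifts
      where
      Mʲ∈𝒞 : InClass γ′ (M ^ₘ j)
      Mʲ∈𝒞 = subst (λ g → InClass g (M ^ₘ j)) γʲ≡γ′ (^ₘ-InClass M j (IsGenerator⇒snd≢0 γ-gen) M∈𝒞
        (subst (λ g → proj₂ g ≢ 0F) (sym γʲ≡γ′) (IsGenerator⇒snd≢0 γ′-gen)))
      Mʲ-shifts : ∀ (i : Fin p) → MapsOnto (M ^ₘ j) (reindex j L (inject₁ i)) (reindex j L (fsuc i))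
      Mʲ-shifts i = subst (λ s → MapsOnto (M ^ₘ j) (L [ j * toℕ (inject₁ i) ]) (L [ s ])) j[i+1]
        (Necklace.^ₘ-shifts L-enum (proj₁ M∈𝒞) M-shifts j (j * toℕ (inject₁ i)))
        where
        j[i+1] : j * toℕ (inject₁ i) + j ≡ j * suc (toℕ i)
        j[i+1] = begin
          j * toℕ (inject₁ i) + j  ≡⟨ cong (λ t → j * t + j) (toℕ-inject₁ i) ⟩
          j * toℕ i + j            ≡⟨ +-comm (j * toℕ i) j ⟩
          j + j * toℕ i            ≡⟨ sym (*-suc j (toℕ i)) ⟩
          j * suc (toℕ i)          ∎

    reindex-~ : ∀ {L L′} → IsNecklace γ L → L ~ L′ → reindex j L ~ reindex j L′
    reindex-~ {L} L-neck = reindex-resp-~ j m {L} ([m*j]≡1 L-neck)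

    reindex-left-inverse : ∀ L → IsNecklace γ L → reindex m (reindex j L) ~ L
    reindex-left-inverse L L-neck = reindex-inverse m j ([m*j]≡1 L-neck) L

mainTheorem1 : (p : ℕ) {{nz : NonZero p}} → Prime p → p % 2 ≡ 1
    → (d : Fin p) → Setup.NonSquare p d d
    → (γ γ' : Setup.Fp2 p d) → Setup.IsGenerator p d γ → Setup.IsGenerator p d γ'
    → Σ (Setup.Enum p d → Setup.Enum p d) λ F → Σ (Setup.Enum p d → Setup.Enum p d) λ G →
        Setup.NecklaceBijection p d γ γ' F G × Setup.Equivariant p d γ F
mainTheorem1 p p-prime _ d _ γ γ′ γ-gen γ′-gen =
    reindex j , reindex m
  , ( T.reindex-IsNecklace , T′.reindex-IsNecklace
    , (λ _ _ L-neck _ → T.reindex-~ L-neck) , (λ _ _ L-neck _ → T′.reindex-~ L-neck)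
    , T.reindex-left-inverse , T′.reindex-left-inverse )
  , reindex-equivariant γ j
  where
  open Setup p d using (pow)
  open Necklaces p d p-prime
  γ-power : ∃ λ j → pow γ j ≡ γ′
  γ-power = γ-gen γ′ (IsGenerator⇒≢0F2 γ′-gen)
  γ′-power : ∃ λ m → pow γ′ m ≡ γ
  γ′-power = γ′-gen γ (IsGenerator⇒≢0F2 γ-gen)
  j m : ℕ
  j = proj₁ γ-power
  m = proj₁ γ′-power
  module T  = Transfer γ-gen γ′-gen (proj₂ γ-power) (proj₂ γ′-power)
  module T′ = Transfer γ′-gen γ-gen (proj₂ γ′-power) (proj₂ γ-power)
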